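{- Let $B$ be a bidirected graph, $\mathcal X,\mathcal Y$ sets of signed vertices of $B$, and $\hat B$, $x$, $y$ constructed as described in the context. Let $T$ be either an $x$--$y$ trail or a nontrivial $x$--$x$ trail in $\hat B$. Then (1) every internal vertex of $T$ has the form $v^\alpha$ for some $v\in V(B)$ and $\alpha\in\{+,-\}$; (2) every internal vertex of $T$ occurs exactly once on $T$; and (3) precisely every second edge of $T$ is of the form $v^\alpha v^{ -\alpha}$ (for some $v\in V(B)$, $\alpha\in\{+,-\}$).
   Context: A bidirected graph $B=(G,\sigma)$ consists of an undirected graph $G$ without loops (no two distinct edges have the same endvertices and the same signs at them) with a signing $\sigma$ assigning to every pair $(u,e)$, $u$ an endvertex of edge $e$, a sign $\sigma(u,e)\in\{+,-\}$. A signed vertex is a pair $(v,\alpha)$. A walk is a sequence $v_0\vec e_1v_1\dots\vec e_\ell v_\ell$, $\vec e_j$ the edge $e_j$ oriented from $v_{j-1}$ to $v_j$, with $\sigma(v_i,e_i)\neq\sigma(v_i,e_{i+1})$ for $1\le i\le\ell-1$; it is nontrivial if $\ell\ge1$; $v_1,\dots,v_{\ell-1}$ are its internal vertices. A trail is a walk with distinct edges; an $a$--$b$ trail is a nontrivial trail with first vertex $a$ and last vertex $b$. Construction of $\hat B=(\hat G,\hat\sigma)$: for each $v\in V(B)$ take two vertices $v^+,v^-$ joined by an edge with sign $+$ at $v^-$ and $-$ at $v^+$. Each edge $e$ of $B$ with endvertices $u,v$ yields an edge $\hat e$ between $u^{\sigma(u,e)}$ and $v^{\sigma(v,e)}$ with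 $\hat\sigma(u^{\sigma(u,e)},\hat e)=\sigma(u,e)$ and $\hat\sigma(v^{\sigma(v,e)},\hat e)=\sigma(v,e)$. Add two new vertices $x,y$; for every $(v,-\alpha)\in\mathcal X$ add an edge between $x$ and $v^\alpha$ with sign $\alpha$ at $v^\alpha$ and $-$ at $x$; for every $(v,-\beta)\in\mathcal Y$ add an edge between $y$ and $v^\beta$ with sign $\beta$ at $v^\beta$ and $-$ at $y$. -}

module Defs where

open import Data.Nat using (ℕ; zero; suc; _≤_; _<_)
open import Data.Fin using (Fin; toℕ; inject₁; fromℕ) renaming (suc to fsuc; zero to fzero)
open import Data.Bool using (Bool; true; false)
open import Data.Product using (Σ; ∃; _×_; _,_; proj₁)
open import Data.Sum using (_⊎_)
open import Relation.Binary.PropositionalEquality using (_≡_; _≢_)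
open import Relation.Nullary using (¬_)

data Sign : Set where
  plus minus : Sign

neg : Sign → Sign
neg plus  = minus
neg minus = plus

-- Raw signed graphs: every edge e has two endvertices end₁ e, end₂ e
-- and signs sgn₁ e = σ(end₁ e, e), sgn₂ e = σ(end₂ e, e).

record SignedGraph : Set₁ where
  field
    V    : Set
    E    : Set
    end₁ : E → V
    end₂ : E → V
    sgn₁ : E → Sign
    sgn₂ : E → Sign

record Bidirected : Set₁ where
  field
    graph : SignedGraph
  open SignedGraph graph public
  field
    loopless   : ∀ e → end₁ e ≢ end₂ e
    noParallel : ∀ e e' →
      ((end₁ e ≡ end₁ e' × end₂ e ≡ end₂ e' × sgn₁ e ≡ sgn₁ e' × sgn₂ e ≡ sgn₂ e')
       ⊎ (end₁ e ≡ end₂ e' × end₂ e ≡ end₁ e' × sgn₁ e ≡ sgn₂ e' × sgn₂ e ≡ sgn₁ e'))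
      → e ≡ e'

module _ (G : SignedGraph) where
  open SignedGraph G

  -- An oriented edge: (e , true) runs from end₁ e to end₂ e,
  -- (e , false) runs from end₂ e to end₁ e.
  OEdge : Set
  OEdge = E × Bool

  tailV : OEdge → V
  tailV (e , true)  = end₁ e
  tailV (e , false) = end₂ e

  headV : OEdge → V
  headV (e , true)  = end₂ e
  headV (e , false) = end₁ e

  tailS : OEdge → Sign
  tailS (e , true)  = sgn₁ e
  tailS (e , false) = sgn₂ e

  headS : OEdge → Sign
  headS (e , true)  = sgn₂ e
  headS (e , false) = sgn₁ e

  -- A walk v₀ e₁ v₁ … e_ℓ v_ℓ : vertices indexed by Fin (suc ℓ),
  -- oriented edges indexed by Fin ℓ (edge i goes from vertex i to vertex i+1).
  record Walk : Set where
    field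
      len    : ℕ
      vert   : Fin (suc len) → V
      edge   : Fin len → OEdge
      tailOk : ∀ i → tailV (edge i) ≡ vert (inject₁ i)
      headOk : ∀ i → headV (edge i) ≡ vert (fsuc i)
      signOk : ∀ i j → toℕ j ≡ suc (toℕ i) → headS (edge i) ≢ tailS (edge j)

  open Walk public

  firstV : Walk → V
  firstV W = vert W fzero

  lastV : Walk → V
  lastV W = vert W (fromℕ (len W))

  Nontrivial : Walk → Set
  Nontrivial W = 1 ≤ len W

  IsTrail : Walk → Set
  IsTrail W = ∀ i j → proj₁ (edge W i) ≡ proj₁ (edge W j) → i ≡ j

  IsTrailBetween : V → V → Walk → Set
  IsTrailBetween a b W = IsTrail W × Nontrivial W × firstV W ≡ a × lastV W ≡ b

  InternalPos : (W : Walk) → Fin (suc (len W)) → Set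
  InternalPos W k = 1 ≤ toℕ k × toℕ k < len W

module Hat (B : Bidirected) (𝒳 𝒴 : Bidirected.V B → Sign → Set) where
  open Bidirected B

  data HV : Set where
    pt : V → Sign → HV     -- pt v α  is  v^α
    x  : HV
    y  : HV

  data HE : Set where
    inner : V → HE
    lift  : E → HE
    xe    : (v : V) (α : Sign) → .(𝒳 v (neg α)) → HE
    ye    : (v : V) (β : Sign) → .(𝒴 v (neg β)) → HE

  hend₁ : HE → HV
  hend₁ (inner v)  = pt v plus
  hend₁ (lift e)   = pt (end₁ e) (sgn₁ e)
  hend₁ (xe v α _) = pt v α
  hend₁ (ye v β _) = pt v β

  hend₂ : HE → HV
  hend₂ (inner v)  = pt v minus
  hend₂ (lift e)   = pt (end₂ e) (sgn₂ e)
  hend₂ (xe v α _) = x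
  hend₂ (ye v β _) = y

  hsgn₁ : HE → Sign
  hsgn₁ (inner v)  = minus
  hsgn₁ (lift e)   = sgn₁ e
  hsgn₁ (xe v α _) = α
  hsgn₁ (ye v β _) = β

  hsgn₂ : HE → Sign
  hsgn₂ (inner v)  = plus
  hsgn₂ (lift e)   = sgn₂ e
  hsgn₂ (xe v α _) = minus
  hsgn₂ (ye v β _) = minus

  B̂ : SignedGraph
  B̂ = record { V = HV ; E = HE ; end₁ = hend₁ ; end₂ = hend₂ ; sgn₁ = hsgn₁ ; sgn₂ = hsgn₂ }

  IsVertexEdge : HE → Set
  IsVertexEdge e = ∃ λ v → ∃ λ α → hend₁ e ≡ pt v α × hend₂ e ≡ pt v (neg α)

{-# OPTIONS --safe #-}
-- At x and y every edge of B̂ carries the sign −, so no walk can pass through them.  At v^α the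
-- edge v⁺v⁻ carries the sign −α and every other edge the sign α, so a walk passing through v^α
-- uses the edge v⁺v⁻ exactly once there, together with one edge that is not of this form.  This
-- gives (1) and (3); for (2), two visits of a trail to v^α would both use the single edge v⁺v⁻,
-- whose two ends are different vertices.
module Submission where

open import Defs
open import Data.Nat using (suc; _≤_; _<_; z≤n; s≤s; s≤s⁻¹)
open import Data.Nat.Properties using (≤∧≢⇒<)
open import Data.Fin using (Fin; toℕ; inject₁; fromℕ; fromℕ<) renaming (suc to fsuc; zero to fzero)
open import Data.Fin.Properties using (toℕ-injective; toℕ-inject₁; toℕ-fromℕ; toℕ-fromℕ<; toℕ<n)
open import Data.Bool using (true; false)
open import Data.Product using (∃; ∃₂; _×_; _,_; proj₁)
open import Data.Sum using (_⊎_; inj₁; inj₂)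
open import Data.Empty using (⊥-elim)
open import Relation.Binary.PropositionalEquality using (_≡_; _≢_; refl; sym; trans; cong; subst)
open import Relation.Nullary using (¬_)
open import Function.Bundles using (_⇔_; mk⇔)

inject₁≡suc : ∀ {n} {i j : Fin n} → toℕ j ≡ suc (toℕ i) → inject₁ j ≡ fsuc i
inject₁≡suc {j = j} j≡1+i = toℕ-injective (trans (toℕ-inject₁ j) j≡1+i)

≢fromℕ⇒toℕ< : ∀ {n} (k : Fin (suc n)) → k ≢ fromℕ n → toℕ k < n
≢fromℕ⇒toℕ< {n} k k≢n =
  ≤∧≢⇒< (s≤s⁻¹ (toℕ<n k)) (λ k≡n → k≢n (toℕ-injective (trans k≡n (sym (toℕ-fromℕ n)))))

interior⇒between-edges : ∀ {n} (k : Fin (suc n)) → 1 ≤ toℕ k → toℕ k < n →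
  ∃₂ λ (i j : Fin n) → toℕ j ≡ suc (toℕ i) × fsuc i ≡ k
interior⇒between-edges (fsuc i) _ i<n = i , fromℕ< i<n , toℕ-fromℕ< i<n , refl

module HatWalks (B : Bidirected) (𝒳 𝒴 : Bidirected.V B → Sign → Set) where
  open Hat B 𝒳 𝒴
  open Bidirected B using (loopless)

  data Terminal : HV → Set where
    x-terminal : Terminal x
    y-terminal : Terminal y

  classify : (w : HV) → Terminal w ⊎ ∃₂ λ v α → w ≡ pt v α
  classify (pt v α) = inj₂ (v , α , refl)
  classify x        = inj₁ x-terminal
  classify y        = inj₁ y-terminal

  pt-injectiveˡ : ∀ {v w α β} → pt v α ≡ pt w β → v ≡ w
  pt-injectiveˡ refl = refl

  inner-isVertexEdge : ∀ v → IsVertexEdge (inner v)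
  inner-isVertexEdge v = v , plus , refl , refl

  lift-notVertexEdge : ∀ e → ¬ IsVertexEdge (lift e)
  lift-notVertexEdge e (_ , _ , end₁≡ , end₂≡) =
    loopless e (trans (pt-injectiveˡ end₁≡) (sym (pt-injectiveˡ end₂≡)))

  xe-notVertexEdge : ∀ v α .p → ¬ IsVertexEdge (xe v α p)
  xe-notVertexEdge _ _ _ (_ , _ , _ , ())

  ye-notVertexEdge : ∀ v β .p → ¬ IsVertexEdge (ye v β p)
  ye-notVertexEdge _ _ _ (_ , _ , _ , ())

  terminal-headS : ∀ o → Terminal (headV B̂ o) → headS B̂ o ≡ minus
  terminal-headS (inner _ , true)    ()
  terminal-headS (inner _ , false)   ()
  terminal-headS (lift _ , true)     ()
  terminal-headS (lift _ , false)    ()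
  terminal-headS (xe _ _ _ , true)   _ = refl
  terminal-headS (xe _ _ _ , false)  ()
  terminal-headS (ye _ _ _ , true)   _ = refl
  terminal-headS (ye _ _ _ , false)  ()

  terminal-tailS : ∀ o → Terminal (tailV B̂ o) → tailS B̂ o ≡ minus
  terminal-tailS (e , true)  = terminal-headS (e , false)
  terminal-tailS (e , false) = terminal-headS (e , true)

  -- EndAt v α e s : the edge e of B̂ is incident with v^α and has the sign s there.
  data EndAt (v : Bidirected.V B) (α : Sign) : HE → Sign → Set where
    inner-end : EndAt v α (inner v) (neg α)
    other-end : ∀ {e} → ¬ IsVertexEdge e → EndAt v α e α

  head-end : ∀ o {v α} → headV B̂ o ≡ pt v α → EndAt v α (proj₁ o) (headS B̂ o)
  head-end (inner _ , true)        refl = inner-end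
  head-end (inner _ , false)       refl = inner-end
  head-end (lift e , true)         refl = other-end (lift-notVertexEdge e)
  head-end (lift e , false)        refl = other-end (lift-notVertexEdge e)
  head-end (xe _ _ _ , true)       ()
  head-end (xe v α p , false)      refl = other-end (xe-notVertexEdge v α p)
  head-end (ye _ _ _ , true)       ()
  head-end (ye v β p , false)      refl = other-end (ye-notVertexEdge v β p)

  tail-end : ∀ o {v α} → tailV B̂ o ≡ pt v α → EndAt v α (proj₁ o) (tailS B̂ o)
  tail-end (e , true)  = head-end (e , false)
  tail-end (e , false) = head-end (e , true)

  Crossing : Bidirected.V B → HE → HE → Set
  Crossing v e₁ e₂ = (e₁ ≡ inner v × ¬ IsVertexEdge e₂) ⊎ (¬ IsVertexEdge e₁ × e₂ ≡ inner v)

  crossing : ∀ {v α e₁ e₂ s₁ s₂} → EndAt v α e₁ s₁ → EndAt v α e₂ s₂ → s₁ ≢ s₂ → Crossing v e₁ e₂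
  crossing inner-end       inner-end       s₁≢s₂ = ⊥-elim (s₁≢s₂ refl)
  crossing inner-end       (other-end ¬ve) _     = inj₁ (refl , ¬ve)
  crossing (other-end ¬ve) inner-end       _     = inj₂ (¬ve , refl)
  crossing (other-end _)   (other-end _)   s₁≢s₂ = ⊥-elim (s₁≢s₂ refl)

  crossing⇒alternates : ∀ {v e₁ e₂} → Crossing v e₁ e₂ → IsVertexEdge e₁ ⇔ (¬ IsVertexEdge e₂)
  crossing⇒alternates {v} (inj₁ (refl , ¬ve₂)) = mk⇔ (λ _ → ¬ve₂) (λ _ → inner-isVertexEdge v)
  crossing⇒alternates {v} (inj₂ (¬ve₁ , refl)) =
    mk⇔ (λ ve₁ → ⊥-elim (¬ve₁ ve₁)) (λ ¬ve₂ → ⊥-elim (¬ve₂ (inner-isVertexEdge v)))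

  junction : ∀ o₁ o₂ → headV B̂ o₁ ≡ tailV B̂ o₂ → headS B̂ o₁ ≢ tailS B̂ o₂ →
    ∃₂ λ v α → headV B̂ o₁ ≡ pt v α × Crossing v (proj₁ o₁) (proj₁ o₂)
  junction o₁ o₂ meet s₁≢s₂ with classify (headV B̂ o₁)
  ... | inj₁ t = ⊥-elim (s₁≢s₂ (trans (terminal-headS o₁ t)
                                      (sym (terminal-tailS o₂ (subst Terminal meet t)))))
  ... | inj₂ (v , α , h) =
    v , α , h , crossing (head-end o₁ h) (tail-end o₂ (trans (sym meet) h)) s₁≢s₂

  inner-not-loop : ∀ o {v} → proj₁ o ≡ inner v → headV B̂ o ≢ tailV B̂ o
  inner-not-loop (inner _ , true)  refl ()
  inner-not-loop (inner _ , false) refl ()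

  module _ (T : Walk B̂) where
    EndPos : Fin (len T) → Fin (suc (len T)) → Set
    EndPos m k = fsuc m ≡ k ⊎ inject₁ m ≡ k

    crossing-at : ∀ i j → toℕ j ≡ suc (toℕ i) →
      ∃₂ λ v α → vert T (fsuc i) ≡ pt v α × Crossing v (proj₁ (edge T i)) (proj₁ (edge T j))
    crossing-at i j j≡1+i
      with junction (edge T i) (edge T j) meet (signOk T i j j≡1+i)
      where
      meet : headV B̂ (edge T i) ≡ tailV B̂ (edge T j)
      meet = trans (headOk T i) (trans (cong (vert T) (sym (inject₁≡suc j≡1+i))) (sym (tailOk T j)))
    ... | v , α , h , c = v , α , trans (sym (headOk T i)) h , c

    alternates : ∀ i j → toℕ j ≡ suc (toℕ i) →
      IsVertexEdge (proj₁ (edge T i)) ⇔ (¬ IsVertexEdge (proj₁ (edge T j)))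
    alternates i j j≡1+i with crossing-at i j j≡1+i
    ... | _ , _ , _ , c = crossing⇒alternates c

    interior⇒inner-edge : ∀ k → InternalPos B̂ T k →
      ∃₂ λ v α → vert T k ≡ pt v α × ∃ λ m → proj₁ (edge T m) ≡ inner v × EndPos m k
    interior⇒inner-edge k (1≤k , k<len) with interior⇒between-edges k 1≤k k<len
    ... | i , j , j≡1+i , refl with crossing-at i j j≡1+i
    ... | v , α , h , inj₁ (eᵢ≡ , _) = v , α , h , i , eᵢ≡ , inj₁ refl
    ... | v , α , h , inj₂ (_ , eⱼ≡) = v , α , h , j , eⱼ≡ , inj₂ (inject₁≡suc j≡1+i)

    inner-edge-ends : ∀ {v m k k'} → proj₁ (edge T m) ≡ inner v →
      EndPos m k → EndPos m k' → vert T k' ≡ vert T k → k' ≡ k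
    inner-edge-ends _ (inj₁ refl) (inj₁ refl) _ = refl
    inner-edge-ends _ (inj₂ refl) (inj₂ refl) _ = refl
    inner-edge-ends {m = m} eₘ≡ (inj₁ refl) (inj₂ refl) same =
      ⊥-elim (inner-not-loop (edge T m) eₘ≡ (trans (headOk T m) (trans (sym same) (sym (tailOk T m)))))
    inner-edge-ends {m = m} eₘ≡ (inj₂ refl) (inj₁ refl) same =
      ⊥-elim (inner-not-loop (edge T m) eₘ≡ (trans (headOk T m) (trans same (sym (tailOk T m)))))

    module _ (trail : IsTrail B̂ T) (first : firstV B̂ T ≡ x) (last : Terminal (lastV B̂ T)) where
      pt⇒interior : ∀ k {v α} → vert T k ≡ pt v α → InternalPos B̂ T k
      pt⇒interior fzero    kpt with () ← trans (sym first) kpt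
      pt⇒interior (fsuc k) kpt = s≤s z≤n , ≢fromℕ⇒toℕ< (fsuc k) not-last
        where
        not-last : fsuc k ≢ fromℕ (len T)
        not-last k≡last with () ← subst Terminal (trans (cong (vert T) (sym k≡last)) kpt) last

      interior-visited-once : ∀ k → InternalPos B̂ T k → ∀ k' → vert T k' ≡ vert T k → k' ≡ k
      interior-visited-once k int k' same with interior⇒inner-edge k int
      ... | v , α , kpt , m , eₘ≡ , m-k with interior⇒inner-edge k' (pt⇒interior k' (trans same kpt))
      ... | v' , _ , k'pt , m' , eₘ'≡ , m'-k'
        with refl ← pt-injectiveˡ (trans (sym k'pt) (trans same kpt))
        with refl ← trail m' m (trans eₘ'≡ (sym eₘ≡)) = inner-edge-ends eₘ≡ m-k m'-k' same

proposition6p4 : (B : Bidirected) (𝒳 𝒴 : Bidirected.V B → Sign → Set)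
    → let open Hat B 𝒳 𝒴 in
      (T : Walk B̂)
    → (IsTrailBetween B̂ x y T ⊎ IsTrailBetween B̂ x x T)
    → ((k : Fin (suc (len T))) → InternalPos B̂ T k
         → ∃ λ v → ∃ λ α → vert T k ≡ pt v α)
      × ((k : Fin (suc (len T))) → InternalPos B̂ T k
         → (k' : Fin (suc (len T))) → vert T k' ≡ vert T k → k' ≡ k)
      × ((i j : Fin (len T)) → toℕ j ≡ suc (toℕ i)
         → IsVertexEdge (proj₁ (edge T i)) ⇔ (¬ IsVertexEdge (proj₁ (edge T j))))
proposition6p4 B 𝒳 𝒴 T ends = interior-is-pt , visited-once ends , alternates T
  where
  open Hat B 𝒳 𝒴
  open HatWalks B 𝒳 𝒴

  interior-is-pt : ∀ k → InternalPos B̂ T k → ∃₂ λ v α → vert T k ≡ pt v α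
  interior-is-pt k int with interior⇒inner-edge T k int
  ... | v , α , kpt , _ = v , α , kpt

  visited-once : IsTrailBetween B̂ x y T ⊎ IsTrailBetween B̂ x x T →
    ∀ k → InternalPos B̂ T k → ∀ k' → vert T k' ≡ vert T k → k' ≡ k
  visited-once (inj₁ (trail , _ , first , last)) =
    interior-visited-once T trail first (subst Terminal (sym last) y-terminal)
  visited-once (inj₂ (trail , _ , first , last)) =
    interior-visited-once T trail first (subst Terminal (sym last) x-terminal)
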